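{- Let $N$, $M$ be chain-groups on $V$, $V'$ respectively. If $M$ is a minor of $N$, then $\lambda_M(T)\le\lambda_N(T\cup U)$ for all $T\subseteq V'$ and all $U\subseteq V\setminus V'$.
   Context: $\mathbb{F}$ is a field, $K=\mathbb{F}^2$ with bilinear form $\langle\,,\,\rangle_K$ equal to $b^+(\binom ab,\binom cd)=ad+bc$ or $b^-(\binom ab,\binom cd)=ad-bc$. A chain on $V$ to $K$ is a map $V\to K$; a chain-group is a subspace of $K^V$. For $T\subseteq V$: $f\cdot T$ is restriction; $N\times T=\{f\cdot T:f\in N, f(x)=0\ \forall x\notin T\}$; $N\setminus T=\{f\cdot(V\setminus T): f\in N,\ \langle f(x),\binom10\rangle_K=0\ \forall x\in T\}$; $N/T=\{f\cdot(V\setminus T): f\in N,\ \langle f(x),\binom01\rangle_K=0\ \forall x\in T\}$. A minor of $N$ is $N/X\setminus Y$ on $V\setminus(X\cup Y)$ for disjoint $X,Y\subseteq V$. $\lambda_N(U)=\frac12(\dim N-\dim(N\times(V\setminus U))-\dim(N\times U))$. -}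

module Defs where

open import Level using (Level; _⊔_) renaming (suc to lsuc)
open import Algebra.Bundles using (CommutativeRing)
open import Data.Nat using (ℕ)
open import Data.Integer using (ℤ; +_) renaming (_-_ to _-ℤ_)
open import Data.Fin using (Fin)
open import Data.Fin.Subset using (Subset; _∈_; _∉_; _─_; _⊆_; _∪_)
open import Data.Bool using (if_then_else_)
open import Data.Vec using (Vec; []; _∷_; lookup)
open import Data.Product using (Σ; _×_; _,_)
open import Relation.Nullary using (¬_)
open import Relation.Binary.PropositionalEquality using (_≡_)

record Field (c ℓ : Level) : Set (lsuc (c ⊔ ℓ)) where
  field
    commutativeRing : CommutativeRing c ℓ
  open CommutativeRing commutativeRing public
  field
    0≉1     : ¬ (0# ≈ 1#)
    inverse : ∀ x → ¬ (x ≈ 0#) → Σ Carrier (λ y → (x * y) ≈ 1#)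

-- Choice of the bilinear form on K = 𝔽²: plus = b⁺, minus = b⁻.
data Sign : Set where
  plus minus : Sign

module _ {c ℓ : Level} (𝔽 : Field c ℓ) (s : Sign) (n : ℕ) where
  open Field 𝔽

  K : Set c
  K = Carrier × Carrier

  _≈K_ : K → K → Set ℓ
  (a , b) ≈K (a' , b') = (a ≈ a') × (b ≈ b')

  0K : K
  0K = 0# , 0#

  ⟪_,_⟫ : K → K → Carrier
  ⟪ (a , b) , (c' , d) ⟫ = form s
    where
    form : Sign → Carrier
    form plus  = (a * d) + (b * c')
    form minus = (a * d) - (b * c')

  e₁ e₂ : K
  e₁ = 1# , 0#
  e₂ = 0# , 1#

  -- Chains: maps from the ambient finite set Fin n to K.  A chain on a
  -- subset S ⊆ Fin n is encoded as a chain on Fin n vanishing outside S.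
  Chain : Set c
  Chain = Fin n → K

  _≈C_ : Chain → Chain → Set ℓ
  f ≈C g = ∀ x → f x ≈K g x

  0C : Chain
  0C = λ _ → 0K

  _+C_ : Chain → Chain → Chain
  (f +C g) x = let (a , b) = f x ; (a' , b') = g x in (a + a') , (b + b')

  _·C_ : Carrier → Chain → Chain
  (k ·C f) x = let (a , b) = f x in (k * a) , (k * b)

  restrict : Chain → Subset n → Chain
  restrict f T x = if lookup T x then f x else 0K

  ChainSet : Set (lsuc (c ⊔ ℓ))
  ChainSet = Chain → Set (c ⊔ ℓ)

  record IsChainGroupOn (S : Subset n) (P : ChainSet) : Set (c ⊔ ℓ) where
    field
      resp    : ∀ f g → f ≈C g → P f → P g
      zero∈   : P 0C
      +-closed : ∀ f g → P f → P g → P (f +C g)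
      ·-closed : ∀ k f → P f → P (k ·C f)
      support : ∀ f → P f → ∀ x → x ∉ S → f x ≈K 0K

  _×ₘ_ : ChainSet → Subset n → ChainSet
  (N ×ₘ T) g = Σ Chain λ f → N f × (∀ x → x ∉ T → f x ≈K 0K) × (g ≈C restrict f T)

  deleteₘ : Subset n → ChainSet → Subset n → ChainSet
  deleteₘ S N T g = Σ Chain λ f → N f × (∀ x → x ∈ T → ⟪ f x , e₁ ⟫ ≈ 0#) × (g ≈C restrict f (S ─ T))

  contractₘ : Subset n → ChainSet → Subset n → ChainSet
  contractₘ S N T g = Σ Chain λ f → N f × (∀ x → x ∈ T → ⟪ f x , e₂ ⟫ ≈ 0#) × (g ≈C restrict f (S ─ T))

  minorₘ : Subset n → ChainSet → Subset n → Subset n → ChainSet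
  minorₘ V N X Y = deleteₘ (V ─ X) (contractₘ V N X) Y

  IsMinor : Subset n → ChainSet → Subset n → ChainSet → Set (c ⊔ ℓ)
  IsMinor V N V' M =
    Σ (Subset n) λ X → Σ (Subset n) λ Y →
      X ⊆ V × Y ⊆ V × (∀ x → x ∈ X → x ∈ Y → Data.Empty.⊥) ×
      V' ≡ V ─ (X ∪ Y) ×
      (∀ g → (M g → minorₘ V N X Y g) × (minorₘ V N X Y g → M g))
    where import Data.Empty

  lincomb : ∀ {d} → Vec Carrier d → Vec Chain d → Chain
  lincomb []       []       = 0C
  lincomb (k ∷ ks) (v ∷ vs) = (k ·C v) +C lincomb ks vs

  HasDim : ChainSet → ℕ → Set (c ⊔ ℓ)
  HasDim P d = Σ (Vec Chain d) λ B →
      (∀ i → P (lookup B i))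
    × (∀ ks → lincomb ks B ≈C 0C → ∀ i → lookup ks i ≈ 0#)
    × (∀ f → P f → Σ (Vec Carrier d) λ ks → f ≈C lincomb ks B)

  TwiceLambda : Subset n → ChainSet → Subset n → ℤ → Set (c ⊔ ℓ)
  TwiceLambda S N U l = Σ ℕ λ a → Σ ℕ λ b → Σ ℕ λ e →
    HasDim N a × HasDim (N ×ₘ (S ─ U)) b × HasDim (N ×ₘ U) e ×
    (l ≡ ((+ a) -ℤ (+ b)) -ℤ (+ e))

module Submission where

-- Let M = N / X ∖ Y on V' = V ∖ (X ∪ Y), and let T ⊆ V', U ⊆ V ∖ V'.
-- Writing d for dimension, 2λ_M(T) ≤ 2λ_N(T ∪ U) is the inequality
--   d M + d(N × (T∪U)) + d(N × (V∖(T∪U)))  ≤  d N + d(M × T) + d(M × (V'∖T)),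
-- i.e. dim M / (M×T ⊕ M×(V'∖T)) ≤ dim N / (N×(T∪U) ⊕ N×(V∖(T∪U))).
-- The chains of M are the restrictions to V' of the chains of a subspace N₀
-- of N.  Lifting a family J of M to N₀ turns a family independent modulo
-- the first direct sum into one independent modulo the second: if a
-- combination F of the lifts lies in N×(T∪U) + N×(V∖(T∪U)), then F·(T∪U)
-- lies in N₀, so F·T and F·(V'∖T) are chains of M, and the combination of
-- J (which is F·V' = F·T + F·(V'∖T)) lies in M×T + M×(V'∖T).

open import Defs
open import Level using (_⊔_)
open import Algebra.Bundles using (Ring)
open import Algebra.Module.Bundles using (LeftModule)
import Algebra.Construct.Pointwise as Pointwise
open import Data.Nat using (ℕ)
open import Data.Fin.Subset using (Subset; _⊆_; _─_; _∪_)
open import Data.Product using (_,_; proj₁; proj₂)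

module FiniteFamilies where
  open import Data.Nat using (suc; zero) renaming (_+_ to _+ℕ_)
  open import Data.Fin using (Fin; zero; suc; _↑ˡ_; _↑ʳ_; splitAt; join)
  open import Data.Fin.Properties using (join-splitAt)
  open import Data.Sum using (inj₁; inj₂; [_,_]′)
  open import Data.Vec.Functional using (Vector; _++_; _∷_; tail)
  open import Function using (_∘_)
  open import Relation.Nullary using (¬_)
  open import Relation.Nullary.Negation using (¬¬-map; negated-stable)
  open import Relation.Binary.PropositionalEquality using (_≡_; refl; sym; trans; cong; _≗_)

  -- Double negation is a monad; its bind is needed across universe levels.
  infixl 1 _>>=¬¬_
  _>>=¬¬_ : ∀ {a b} {A : Set a} {B : Set b} → ¬ ¬ A → (A → ¬ ¬ B) → ¬ ¬ B
  m >>=¬¬ f = negated-stable (¬¬-map f m)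

  return¬¬ : ∀ {a} {A : Set a} → A → ¬ ¬ A
  return¬¬ a k = k a

  ¬¬-∀Fin : ∀ {a} p {Q : Fin p → Set a} → (∀ i → ¬ ¬ Q i) → ¬ ¬ (∀ i → Q i)
  ¬¬-∀Fin zero    h = return¬¬ (λ ())
  ¬¬-∀Fin (suc p) h =
    h zero >>=¬¬ λ q₀ → ¬¬-∀Fin p (h ∘ suc) >>=¬¬ λ qs →
    return¬¬ λ { zero → q₀ ; (suc i) → qs i }

  module _ {a} {A : Set a} where
    ++-suc : ∀ {p q} (u : Vector A (suc p)) (v : Vector A q) i → (u ++ v) (suc i) ≡ (tail u ++ v) i
    ++-suc {p} u v i with splitAt p i
    ... | inj₁ j = refl
    ... | inj₂ j = refl

    ++-split : ∀ {p q} (c : Vector A (p +ℕ q)) → c ≗ (c ∘ (_↑ˡ q)) ++ (c ∘ (p ↑ʳ_))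
    ++-split {p} {q} c i = trans (cong c (sym (join-splitAt p q i))) (via-join (splitAt p i))
      where
      via-join : ∀ s → c (join p q s) ≡ [ c ∘ (_↑ˡ q) , c ∘ (p ↑ʳ_) ]′ s
      via-join (inj₁ j) = refl
      via-join (inj₂ j) = refl

    ++-∀ : ∀ {p q ℓ} {P : A → Set ℓ} (u : Vector A p) (v : Vector A q) →
      (∀ i → P (u i)) → (∀ j → P (v j)) → ∀ i → P ((u ++ v) i)
    ++-∀ {p} u v Pu Pv i with splitAt p i
    ... | inj₁ j = Pu j
    ... | inj₂ j = Pv j

    ∷-++ : ∀ {p q} (b : A) (u : Vector A p) (v : Vector A q) → (b ∷ u) ++ v ≗ b ∷ (u ++ v)
    ∷-++ b u v zero    = refl
    ∷-++ b u v (suc i) = ++-suc (b ∷ u) v i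

module Arithmetic where
  open import Data.Nat using (_≤_) renaming (_+_ to _+ℕ_)
  open import Data.Nat.Properties using (+-monoˡ-≤; +-assoc; +-comm; module ≤-Reasoning)
  open import Relation.Binary.PropositionalEquality using (cong)

  ≤-exchange : ∀ {m n r k l} → m ≤ r +ℕ k → r +ℕ l ≤ n → m +ℕ l ≤ n +ℕ k
  ≤-exchange {m} {n} {r} {k} {l} m≤r+k r+l≤n = begin
    m +ℕ l        ≤⟨ +-monoˡ-≤ l m≤r+k ⟩
    r +ℕ k +ℕ l   ≡⟨ +-assoc r k l ⟩
    r +ℕ (k +ℕ l) ≡⟨ cong (r +ℕ_) (+-comm k l) ⟩
    r +ℕ (l +ℕ k) ≡⟨ +-assoc r l k ⟨
    r +ℕ l +ℕ k   ≤⟨ +-monoˡ-≤ k r+l≤n ⟩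
    n +ℕ k        ∎
    where open ≤-Reasoning

module IntegerArithmetic where
  open import Data.Nat using () renaming (_+_ to _+ℕ_; _≤_ to _≤ℕ_)
  open import Data.Integer using (ℤ; _≤_; +_; _+_; _-_; -_; +≤+)
  open import Data.Integer.Properties using (pos-+; +-monoˡ-≤; module ≤-Reasoning)
  open import Data.Integer.Tactic.RingSolver using (solve-∀)
  open import Relation.Binary.PropositionalEquality using (_≡_; cong; trans)

  difference-≤ : ∀ {a b e a' b' e'} → a' +ℕ (e +ℕ b) ≤ℕ a +ℕ (e' +ℕ b') →
    (+ a' - + b') - + e' ≤ (+ a - + b) - + e
  difference-≤ {a} {b} {e} {a'} {b'} {e'} h = begin
    (+ a' - + b') - + e'       ≡⟨ regroupˡ (+ a') (+ b') (+ e') (+ e) (+ b) ⟩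
    (+ a' + (+ e + + b)) - Q   ≡⟨ cong (_- Q) (pos-+₃ a' e b) ⟨
    + (a' +ℕ (e +ℕ b)) - Q     ≤⟨ +-monoˡ-≤ (- Q) (+≤+ h) ⟩
    + (a +ℕ (e' +ℕ b')) - Q    ≡⟨ cong (_- Q) (pos-+₃ a e' b') ⟩
    (+ a + (+ e' + + b')) - Q  ≡⟨ regroupʳ (+ a) (+ b) (+ e) (+ e') (+ b') ⟨
    (+ a - + b) - + e          ∎
    where
    open ≤-Reasoning
    Q : ℤ
    Q = (+ e + + b) + (+ e' + + b')
    pos-+₃ : ∀ x y z → + (x +ℕ (y +ℕ z)) ≡ + x + (+ y + + z)
    pos-+₃ x y z = trans (pos-+ x (y +ℕ z)) (cong (λ t → + x + t) (pos-+ y z))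
    regroupˡ : ∀ x y z u v → (x - y) - z ≡ (x + (u + v)) - ((u + v) + (z + y))
    regroupˡ = solve-∀
    regroupʳ : ∀ x y z u v → (x - y) - z ≡ (x + (u + v)) - ((z + y) + (u + v))
    regroupʳ = solve-∀

module SubsetFacts where
  open import Data.Fin using (Fin)
  open import Data.Fin.Subset using (_∈_; _∉_; inside; outside)
  open import Data.Vec using (_∷_)
  open import Data.Vec.Base using (here; there)

  x∈p─q⇒x∉q : ∀ {m} {x : Fin m} {p q : Subset m} → x ∈ p ─ q → x ∉ q
  x∈p─q⇒x∉q {p = _ ∷ _} {outside ∷ _} here      ()
  x∈p─q⇒x∉q {p = _ ∷ _} {outside ∷ _} (there x∈) (there x∈q) = x∈p─q⇒x∉q x∈ x∈q
  x∈p─q⇒x∉q {p = _ ∷ _} {inside  ∷ _} (there x∈) (there x∈q) = x∈p─q⇒x∉q x∈ x∈q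

module FieldFacts {c ℓ} (𝔽 : Field c ℓ) where
  open Field 𝔽
  open import Algebra.Properties.Ring ring using (-‿distribˡ-*)
  open import Relation.Binary.Reasoning.Setoid setoid

  eliminate : ∀ a b y → b * y ≈ 1# → a + - (a * y) * b ≈ 0#
  eliminate a b y b*y≈1 = begin
    a + - (a * y) * b   ≈⟨ +-congˡ (-‿distribˡ-* (a * y) b) ⟨
    a + - (a * y * b)   ≈⟨ +-congˡ (-‿cong (*-assoc a y b)) ⟩
    a + - (a * (y * b)) ≈⟨ +-congˡ (-‿cong (*-congˡ (trans (*-comm y b) b*y≈1))) ⟩
    a + - (a * 1#)      ≈⟨ +-congˡ (-‿cong (*-identityʳ a)) ⟩
    a + - a             ≈⟨ -‿inverseʳ a ⟩
    0#                  ∎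

pointwise : ∀ {r ℓr m ℓm a} {R : Ring r ℓr} (A : Set a) →
  LeftModule R m ℓm → LeftModule R (a ⊔ m) (a ⊔ ℓm)
pointwise A M = record
  { Carrierᴹ = A → Carrierᴹ
  ; _≈ᴹ_     = λ f g → ∀ x → f x ≈ᴹ g x
  ; _+ᴹ_     = λ f g x → f x +ᴹ g x
  ; _*ₗ_     = λ k f x → k *ₗ f x
  ; 0ᴹ       = λ _ → 0ᴹ
  ; -ᴹ_      = λ f x → -ᴹ f x
  ; isLeftModule = record
    { isLeftSemimodule = record
      { +ᴹ-isCommutativeMonoid = Pointwise.isCommutativeMonoid A +ᴹ-isCommutativeMonoid
      ; isPreleftSemimodule = record
        { *ₗ-cong     = λ k≈l f≈g x → *ₗ-cong k≈l (f≈g x)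
        ; *ₗ-zeroˡ    = λ f x → *ₗ-zeroˡ (f x)
        ; *ₗ-distribʳ = λ f k l x → *ₗ-distribʳ (f x) k l
        ; *ₗ-identityˡ = λ f x → *ₗ-identityˡ (f x)
        ; *ₗ-assoc    = λ k l f x → *ₗ-assoc k l (f x)
        ; *ₗ-zeroʳ    = λ k x → *ₗ-zeroʳ k
        ; *ₗ-distribˡ = λ k f g x → *ₗ-distribˡ k (f x) (g x)
        }
      }
    ; -ᴹ‿cong    = λ f≈g x → -ᴹ‿cong (f≈g x)
    ; -ᴹ‿inverse = (λ f x → -ᴹ‿inverseˡ (f x)) , (λ f x → -ᴹ‿inverseʳ (f x))
    }
  }
  where open LeftModule M

module LinearAlgebra {c ℓ} (𝔽 : Field c ℓ) {m ℓm} (W : LeftModule (Field.ring 𝔽) m ℓm) where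
  open import Data.Nat using (zero; suc; _≤_; _≤?_; z≤n; s≤s) renaming (_+_ to _+ℕ_)
  open import Data.Nat.Properties using (m≤n⇒m≤1+n)
  open import Data.Fin using (Fin; zero; suc; punchIn; _↑ˡ_; _↑ʳ_; splitAt)
  open import Data.Product using (Σ-syntax; _×_)
  open import Data.Sum using (inj₁; inj₂)
  open import Data.Vec.Functional using (_++_; _∷_; tail; insertAt; removeAt)
  open import Data.Vec.Functional.Properties using (insertAt-lookup; insertAt-punchIn)
  open import Function using (_∘_)
  open import Relation.Nullary using (¬_; yes; no)
  open import Relation.Nullary.Negation using (¬∃⟶∀¬; ¬¬-map)
  open import Relation.Nullary.Decidable using (¬¬-excluded-middle; decidable-stable)
  open import Relation.Binary.PropositionalEquality as ≡ using (_≗_)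
  open FiniteFamilies
  open Arithmetic using (≤-exchange)
  open FieldFacts 𝔽 using (eliminate)
  open Field 𝔽 hiding (zero)
  open LeftModule W
  open import Algebra.Properties.CommutativeMonoid.Sum +ᴹ-commutativeMonoid
    using (sum; sum-cong-≋; sum-cong-≗; sum-replicate-zero; ∑-distrib-+; sum-remove)
  open import Algebra.Properties.Monoid.Sum +-monoid using () renaming (sum to ∑)
  open import Algebra.Properties.AbelianGroup +ᴹ-abelianGroup using (inverseˡ-unique) public
  open import Algebra.Properties.Ring ring using (-1*x≈-x)
  import Relation.Binary.Reasoning.Setoid as SetoidReasoning
  open SetoidReasoning ≈ᴹ-setoid

  sum-++ : ∀ {p q} (u : Fin p → Carrierᴹ) (v : Fin q → Carrierᴹ) → sum (u ++ v) ≈ᴹ sum u +ᴹ sum v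
  sum-++ {zero}  u v = ≈ᴹ-sym (+ᴹ-identityˡ (sum v))
  sum-++ {suc p} u v = begin
    u zero +ᴹ sum ((u ++ v) ∘ suc)    ≈⟨ +ᴹ-cong ≈ᴹ-refl (≈ᴹ-reflexive (sum-cong-≗ (++-suc u v))) ⟩
    u zero +ᴹ sum (tail u ++ v)       ≈⟨ +ᴹ-cong ≈ᴹ-refl (sum-++ (tail u) v) ⟩
    u zero +ᴹ (sum (tail u) +ᴹ sum v) ≈⟨ ≈ᴹ-sym (+ᴹ-assoc _ _ _) ⟩
    sum u +ᴹ sum v                    ∎

  lc : ∀ {p} → (Fin p → Carrier) → (Fin p → Carrierᴹ) → Carrierᴹ
  lc a u = sum (λ i → a i *ₗ u i)

  lc-cong : ∀ {p} {a b : Fin p → Carrier} {u v : Fin p → Carrierᴹ} →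
    (∀ i → a i ≈ b i) → (∀ i → u i ≈ᴹ v i) → lc a u ≈ᴹ lc b v
  lc-cong a≈b u≈v = sum-cong-≋ (λ i → *ₗ-cong (a≈b i) (u≈v i))

  lc-≗ : ∀ {p} a {u v : Fin p → Carrierᴹ} → u ≗ v → lc a u ≈ᴹ lc a v
  lc-≗ a u≗v = lc-cong (λ _ → refl) (≈ᴹ-reflexive ∘ u≗v)

  sum-zero : ∀ {p} (f : Fin p → Carrierᴹ) → (∀ i → f i ≈ᴹ 0ᴹ) → sum f ≈ᴹ 0ᴹ
  sum-zero {p} f f≈0 = ≈ᴹ-trans (sum-cong-≋ f≈0) (sum-replicate-zero p)

  lc-zero : ∀ {p} {a : Fin p → Carrier} (u : Fin p → Carrierᴹ) → (∀ i → a i ≈ 0#) → lc a u ≈ᴹ 0ᴹ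
  lc-zero u a≈0 = sum-zero _ (λ i → ≈ᴹ-trans (*ₗ-cong (a≈0 i) ≈ᴹ-refl) (*ₗ-zeroˡ (u i)))

  lc-zeroᵛ : ∀ {p} (a : Fin p → Carrier) {u : Fin p → Carrierᴹ} → (∀ i → u i ≈ᴹ 0ᴹ) → lc a u ≈ᴹ 0ᴹ
  lc-zeroᵛ a u≈0 = sum-zero _ (λ i → ≈ᴹ-trans (*ₗ-cong refl (u≈0 i)) (*ₗ-zeroʳ (a i)))

  lc-+ : ∀ {p} (a b : Fin p → Carrier) u → lc a u +ᴹ lc b u ≈ᴹ lc (λ i → a i + b i) u
  lc-+ a b u = begin
    lc a u +ᴹ lc b u                    ≈⟨ ∑-distrib-+ (λ i → a i *ₗ u i) (λ i → b i *ₗ u i) ⟨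
    sum (λ i → a i *ₗ u i +ᴹ b i *ₗ u i) ≈⟨ sum-cong-≋ (λ i → *ₗ-distribʳ (u i) (a i) (b i)) ⟨
    lc (λ i → a i + b i) u              ∎

  lc-*ₗ : ∀ {p} k (a : Fin p → Carrier) u → k *ₗ lc a u ≈ᴹ lc (λ i → k * a i) u
  lc-*ₗ {zero}  k a u = *ₗ-zeroʳ k
  lc-*ₗ {suc p} k a u = ≈ᴹ-trans (*ₗ-distribˡ k _ _)
    (+ᴹ-cong (≈ᴹ-sym (*ₗ-assoc k _ _)) (lc-*ₗ k (tail a) (tail u)))

  lc-+ᴹ : ∀ {p} (a : Fin p → Carrier) u v → lc a (λ i → u i +ᴹ v i) ≈ᴹ lc a u +ᴹ lc a v
  lc-+ᴹ a u v = begin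
    lc a (λ i → u i +ᴹ v i)              ≈⟨ sum-cong-≋ (λ i → *ₗ-distribˡ (a i) (u i) (v i)) ⟩
    sum (λ i → a i *ₗ u i +ᴹ a i *ₗ v i) ≈⟨ ∑-distrib-+ (λ i → a i *ₗ u i) (λ i → a i *ₗ v i) ⟩
    lc a u +ᴹ lc a v                     ∎

  lc-++ : ∀ {p q} (a : Fin p → Carrier) (b : Fin q → Carrier) u v →
    lc (a ++ b) (u ++ v) ≈ᴹ lc a u +ᴹ lc b v
  lc-++ {p} a b u v = ≈ᴹ-trans (≈ᴹ-reflexive (sum-cong-≗ termwise)) (sum-++ (λ j → a j *ₗ u j) (λ j → b j *ₗ v j))
    where
    termwise : (λ i → (a ++ b) i *ₗ (u ++ v) i) ≗ ((λ j → a j *ₗ u j) ++ (λ j → b j *ₗ v j))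
    termwise i with splitAt p i
    ... | inj₁ j = ≡.refl
    ... | inj₂ j = ≡.refl

  lc-split : ∀ {p q} (a : Fin (p +ℕ q) → Carrier) u v →
    lc a (u ++ v) ≈ᴹ lc (a ∘ (_↑ˡ q)) u +ᴹ lc (a ∘ (p ↑ʳ_)) v
  lc-split {p} a u v = ≈ᴹ-trans (lc-cong (λ i → reflexive (++-split {p = p} a i)) (λ _ → ≈ᴹ-refl))
                                (lc-++ _ _ u v)

  lc-remove : ∀ {p} (a : Fin (suc p) → Carrier) u k →
    lc a u ≈ᴹ a k *ₗ u k +ᴹ lc (removeAt a k) (removeAt u k)
  lc-remove a u k = sum-remove {i = k} (λ i → a i *ₗ u i)

  ∑-*ₗ : ∀ {p} (a : Fin p → Carrier) x → ∑ a *ₗ x ≈ᴹ lc a (λ _ → x)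
  ∑-*ₗ {zero}  a x = *ₗ-zeroˡ x
  ∑-*ₗ {suc p} a x = ≈ᴹ-trans (*ₗ-distribʳ x _ _) (+ᴹ-cong ≈ᴹ-refl (∑-*ₗ (tail a) x))

  record IsLinear (φ : Carrierᴹ → Carrierᴹ) : Set (c ⊔ m ⊔ ℓm) where
    field
      cong   : ∀ {x y} → x ≈ᴹ y → φ x ≈ᴹ φ y
      +-hom  : ∀ x y → φ (x +ᴹ y) ≈ᴹ φ x +ᴹ φ y
      *ₗ-hom : ∀ k x → φ (k *ₗ x) ≈ᴹ k *ₗ φ x

    0-hom : φ 0ᴹ ≈ᴹ 0ᴹ
    0-hom = begin
      φ 0ᴹ         ≈⟨ cong (*ₗ-zeroˡ 0ᴹ) ⟨
      φ (0# *ₗ 0ᴹ) ≈⟨ *ₗ-hom 0# 0ᴹ ⟩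
      0# *ₗ φ 0ᴹ   ≈⟨ *ₗ-zeroˡ (φ 0ᴹ) ⟩
      0ᴹ           ∎

    lc-hom : ∀ {p} (a : Fin p → Carrier) u → φ (lc a u) ≈ᴹ lc a (φ ∘ u)
    lc-hom {zero}  a u = 0-hom
    lc-hom {suc p} a u = ≈ᴹ-trans (+-hom _ _) (+ᴹ-cong (*ₗ-hom (a zero) (u zero)) (lc-hom (tail a) (tail u)))

  open IsLinear public

  -‿*ₗ : ∀ k x → (- k) *ₗ x ≈ᴹ -ᴹ (k *ₗ x)
  -‿*ₗ k x = inverseˡ-unique ((- k) *ₗ x) (k *ₗ x) (begin
    (- k) *ₗ x +ᴹ k *ₗ x ≈⟨ *ₗ-distribʳ x (- k) k ⟨
    (- k + k) *ₗ x       ≈⟨ *ₗ-cong (-‿inverseˡ k) ≈ᴹ-refl ⟩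
    0# *ₗ x              ≈⟨ *ₗ-zeroˡ x ⟩
    0ᴹ                   ∎)

  lc-neg : ∀ {p} (a : Fin p → Carrier) u → lc (λ i → - a i) u ≈ᴹ -ᴹ lc a u
  lc-neg a u = begin
    lc (λ i → - a i) u        ≈⟨ lc-cong (λ i → -1*x≈-x (a i)) (λ _ → ≈ᴹ-refl) ⟨
    lc (λ i → - 1# * a i) u   ≈⟨ lc-*ₗ (- 1#) a u ⟨
    (- 1#) *ₗ lc a u          ≈⟨ -‿*ₗ 1# (lc a u) ⟩
    -ᴹ (1# *ₗ lc a u)         ≈⟨ -ᴹ‿cong (*ₗ-identityˡ (lc a u)) ⟩
    -ᴹ lc a u                 ∎

  -ᴹ-cancelˡ : ∀ x y → -ᴹ x +ᴹ (x +ᴹ y) ≈ᴹ y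
  -ᴹ-cancelˡ x y = begin
    -ᴹ x +ᴹ (x +ᴹ y)  ≈⟨ +ᴹ-assoc (-ᴹ x) x y ⟨
    (-ᴹ x +ᴹ x) +ᴹ y  ≈⟨ +ᴹ-cong (-ᴹ‿inverseˡ x) ≈ᴹ-refl ⟩
    0ᴹ +ᴹ y           ≈⟨ +ᴹ-identityˡ y ⟩
    y                 ∎

  record IsSubspace {p} (P : Carrierᴹ → Set p) : Set (c ⊔ m ⊔ ℓm ⊔ p) where
    field
      resp : ∀ {x y} → x ≈ᴹ y → P x → P y
      0∈   : P 0ᴹ
      +∈   : ∀ {x y} → P x → P y → P (x +ᴹ y)
      *ₗ∈  : ∀ k {x} → P x → P (k *ₗ x)

    -ᴹ∈ : ∀ {x} → P x → P (-ᴹ x)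
    -ᴹ∈ {x} x∈ = resp (≈ᴹ-trans (-‿*ₗ 1# x) (-ᴹ‿cong (*ₗ-identityˡ x))) (*ₗ∈ (- 1#) x∈)

    lc∈ : ∀ {q} (a : Fin q → Carrier) (u : Fin q → Carrierᴹ) → (∀ i → P (u i)) → P (lc a u)
    lc∈ {zero}  a u u∈ = 0∈
    lc∈ {suc q} a u u∈ = +∈ (*ₗ∈ (a zero) (u∈ zero)) (lc∈ (tail a) (tail u) (u∈ ∘ suc))

  open IsSubspace public

  ∩-subspace : ∀ {p q} {P : Carrierᴹ → Set p} {Q : Carrierᴹ → Set q} →
    IsSubspace P → IsSubspace Q → IsSubspace (λ x → P x × Q x)
  ∩-subspace SP SQ = record
    { resp = λ x≈y (px , qx) → resp SP x≈y px , resp SQ x≈y qx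
    ; 0∈   = 0∈ SP , 0∈ SQ
    ; +∈   = λ (px , qx) (py , qy) → +∈ SP px py , +∈ SQ qx qy
    ; *ₗ∈  = λ k (px , qx) → *ₗ∈ SP k px , *ₗ∈ SQ k qx
    }

  -- Equality in 𝔽 is undecidable, so a vanishing
  -- combination is only required to have coefficients that cannot be
  -- nonzero; this is what elimination arguments produce constructively.
  Independent : ∀ {p} → (Fin p → Carrierᴹ) → Set (c ⊔ ℓ ⊔ ℓm)
  Independent u = ∀ a → lc a u ≈ᴹ 0ᴹ → ∀ i → ¬ ¬ (a i ≈ 0#)

  infix 4 _∈Span_
  _∈Span_ : ∀ {q} → Carrierᴹ → (Fin q → Carrierᴹ) → Set (c ⊔ ℓm)
  x ∈Span u = Σ[ a ∈ (Fin _ → Carrier) ] x ≈ᴹ lc a u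

  independent-≗ : ∀ {p} {u v : Fin p → Carrierᴹ} → u ≗ v → Independent u → Independent v
  independent-≗ u≗v ind a lc≈0 = ind a (≈ᴹ-trans (lc-≗ a u≗v) lc≈0)

  ∈Span-≗ : ∀ {q} {u v : Fin q → Carrierᴹ} {x} → u ≗ v → x ∈Span u → x ∈Span v
  ∈Span-≗ u≗v (a , x≈) = a , ≈ᴹ-trans x≈ (lc-≗ a u≗v)

  ∈Span-∷ : ∀ {q} {u : Fin q → Carrierᴹ} {x} b → x ∈Span u → x ∈Span (b ∷ u)
  ∈Span-∷ b (a , x≈) = (0# ∷ a) , ≈ᴹ-trans x≈
    (≈ᴹ-sym (≈ᴹ-trans (+ᴹ-cong (*ₗ-zeroˡ b) ≈ᴹ-refl) (+ᴹ-identityˡ _)))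

  ∷-∈Span : ∀ {q} (b : Carrierᴹ) (u : Fin q → Carrierᴹ) → b ∈Span (b ∷ u)
  ∷-∈Span b u = (1# ∷ λ _ → 0#) , ≈ᴹ-sym (begin
    1# *ₗ b +ᴹ lc (λ _ → 0#) u ≈⟨ +ᴹ-cong (*ₗ-identityˡ b) (lc-zero u (λ _ → refl)) ⟩
    b +ᴹ 0ᴹ                    ≈⟨ +ᴹ-identityʳ b ⟩
    b                          ∎)

  lc-tail : ∀ {q} (a : Fin (suc q) → Carrier) (w : Fin (suc q) → Carrierᴹ) →
    a zero ≈ 0# → lc a w ≈ᴹ lc (tail a) (tail w)
  lc-tail a w a₀≈0 = ≈ᴹ-trans (+ᴹ-cong (≈ᴹ-trans (*ₗ-cong a₀≈0 ≈ᴹ-refl) (*ₗ-zeroˡ (w zero))) ≈ᴹ-refl)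
                              (+ᴹ-identityˡ _)

  -- Let u₀,…,uₚ lie in the span of w₀,…,w_q, and let
  -- uₖ have a nonzero w₀-coordinate.  Subtracting multiples of uₖ from the
  -- other uᵢ clears their w₀-coordinates: the p reduced vectors lie in the
  -- span of w₁,…,w_q, and they are independent when the uᵢ are.
  module Pivot {p q} (u : Fin (suc p) → Carrierᴹ) (w : Fin (suc q) → Carrierᴹ)
    (coord : Fin (suc p) → Fin (suc q) → Carrier) (u≈ : ∀ i → u i ≈ᴹ lc (coord i) w)
    (k : Fin (suc p)) (pivot≉0 : ¬ coord k zero ≈ 0#) where

    pivot⁻¹ : Carrier
    pivot⁻¹ = proj₁ (inverse (coord k zero) pivot≉0)

    ratio : Fin p → Carrier
    ratio i = - (coord (punchIn k i) zero * pivot⁻¹)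

    reduced : Fin p → Carrierᴹ
    reduced i = u (punchIn k i) +ᴹ ratio i *ₗ u k

    cleared : ∀ i → coord (punchIn k i) zero + ratio i * coord k zero ≈ 0#
    cleared i = eliminate (coord (punchIn k i) zero) (coord k zero) pivot⁻¹
                          (proj₂ (inverse (coord k zero) pivot≉0))

    reduced∈span : ∀ i → reduced i ∈Span tail w
    reduced∈span i = tail combined , (begin
      u (punchIn k i) +ᴹ ratio i *ₗ u k
        ≈⟨ +ᴹ-cong (u≈ (punchIn k i)) (*ₗ-cong refl (u≈ k)) ⟩
      lc (coord (punchIn k i)) w +ᴹ ratio i *ₗ lc (coord k) w
        ≈⟨ +ᴹ-cong ≈ᴹ-refl (lc-*ₗ (ratio i) (coord k) w) ⟩
      lc (coord (punchIn k i)) w +ᴹ lc (λ j → ratio i * coord k j) w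
        ≈⟨ lc-+ (coord (punchIn k i)) (λ j → ratio i * coord k j) w ⟩
      lc combined w
        ≈⟨ lc-tail combined w (cleared i) ⟩
      lc (tail combined) (tail w) ∎)
      where
      combined : Fin (suc q) → Carrier
      combined j = coord (punchIn k i) j + ratio i * coord k j

    reduced-independent : Independent u → Independent reduced
    reduced-independent ind t lc≈0 i =
      ¬¬-map (trans (reflexive (≡.sym (insertAt-punchIn t k a i)))) (ind U lcU≈0 (punchIn k i))
      where
      -- the relation Σ tᵢ reducedᵢ = 0, rewritten as a relation among the uᵢ
      a : Carrier
      a = ∑ (λ i → t i * ratio i)
      U : Fin (suc p) → Carrier
      U = insertAt t k a
      lcU≈0 : lc U u ≈ᴹ 0ᴹ
      lcU≈0 = begin
        lc U u
          ≈⟨ lc-remove U u k ⟩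
        U k *ₗ u k +ᴹ lc (removeAt U k) (removeAt u k)
          ≈⟨ +ᴹ-cong (*ₗ-cong (reflexive (insertAt-lookup t k a)) ≈ᴹ-refl)
                     (lc-cong (reflexive ∘ insertAt-punchIn t k a) (λ _ → ≈ᴹ-refl)) ⟩
        a *ₗ u k +ᴹ lc t (removeAt u k)
          ≈⟨ +ᴹ-cong (∑-*ₗ (λ i → t i * ratio i) (u k)) ≈ᴹ-refl ⟩
        lc (λ i → t i * ratio i) (λ _ → u k) +ᴹ lc t (removeAt u k)
          ≈⟨ +ᴹ-comm _ _ ⟩
        lc t (removeAt u k) +ᴹ lc (λ i → t i * ratio i) (λ _ → u k)
          ≈⟨ +ᴹ-cong ≈ᴹ-refl (sum-cong-≋ (λ i → *ₗ-assoc (t i) (ratio i) (u k))) ⟩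
        lc t (removeAt u k) +ᴹ lc t (λ i → ratio i *ₗ u k)
          ≈⟨ lc-+ᴹ t (removeAt u k) (λ i → ratio i *ₗ u k) ⟨
        lc t reduced
          ≈⟨ lc≈0 ⟩
        0ᴹ ∎

  steinitz : ∀ q {p} (u : Fin p → Carrierᴹ) (w : Fin q → Carrierᴹ) → Independent u →
    (∀ i → u i ∈Span w) → ¬ ¬ (p ≤ q)
  steinitz _       {zero}  u w ind u∈ = return¬¬ z≤n
  steinitz zero    {suc p} u w ind u∈ = λ _ → ind (λ _ → 1#) ones≈0 zero (0≉1 ∘ sym)
    where
    ones≈0 : lc (λ _ → 1#) u ≈ᴹ 0ᴹ
    ones≈0 = lc-zeroᵛ (λ _ → 1#) (proj₂ ∘ u∈)
  steinitz (suc q) {suc p} u w ind u∈ =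
    ¬¬-excluded-middle {A = Σ[ k ∈ Fin (suc p) ] ¬ coord k zero ≈ 0#} >>=¬¬ λ where
      (yes (k , pivot≉0)) → let open Pivot u w coord (proj₂ ∘ u∈) k pivot≉0 in
        ¬¬-map s≤s (steinitz q reduced (tail w) (reduced-independent ind) reduced∈span)
      (no no-pivot) → ¬¬-∀Fin (suc p) (¬∃⟶∀¬ no-pivot) >>=¬¬ λ coord₀≈0 →
        ¬¬-map m≤n⇒m≤1+n (steinitz q u (tail w) ind
          (λ i → tail (coord i) , ≈ᴹ-trans (proj₂ (u∈ i)) (lc-tail (coord i) w (coord₀≈0 i))))
    where
    coord : Fin (suc p) → Fin (suc q) → Carrier
    coord i = proj₁ (u∈ i)

  independent-∷ : ∀ {q} {u : Fin q → Carrierᴹ} {b} → Independent u → ¬ b ∈Span u →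
    Independent (b ∷ u)
  independent-∷ {u = u} {b} ind b∉ a lc≈0 = λ where
      zero    → head≈0
      (suc i) → head≈0 >>=¬¬ λ a₀≈0 → ind (tail a) (rest≈0 a₀≈0) i
    where
    rest : Carrierᴹ
    rest = lc (tail a) u

    rest≈0 : a zero ≈ 0# → rest ≈ᴹ 0ᴹ
    rest≈0 a₀≈0 = begin
      rest                    ≈⟨ +ᴹ-identityˡ rest ⟨
      0ᴹ +ᴹ rest              ≈⟨ +ᴹ-cong (≈ᴹ-trans (*ₗ-cong a₀≈0 ≈ᴹ-refl) (*ₗ-zeroˡ b)) ≈ᴹ-refl ⟨
      a zero *ₗ b +ᴹ rest     ≈⟨ lc≈0 ⟩
      0ᴹ                      ∎

    -- if a₀ were invertible, b = −a₀⁻¹ · rest would lie in the span of u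
    head≈0 : ¬ ¬ (a zero ≈ 0#)
    head≈0 a₀≉0 = b∉ ((λ i → (- y) * a (suc i)) , (begin
      b                          ≈⟨ *ₗ-identityˡ b ⟨
      1# *ₗ b                    ≈⟨ *ₗ-cong (trans (*-comm y (a zero)) a₀*y≈1) ≈ᴹ-refl ⟨
      (y * a zero) *ₗ b          ≈⟨ *ₗ-assoc y (a zero) b ⟩
      y *ₗ (a zero *ₗ b)         ≈⟨ inverseˡ-unique _ _ scaled ⟩
      -ᴹ (y *ₗ rest)             ≈⟨ -‿*ₗ y rest ⟨
      (- y) *ₗ rest              ≈⟨ lc-*ₗ (- y) (tail a) u ⟩
      lc (λ i → (- y) * a (suc i)) u ∎))
      where
      y : Carrier
      y = proj₁ (inverse (a zero) a₀≉0)
      a₀*y≈1 : a zero * y ≈ 1#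
      a₀*y≈1 = proj₂ (inverse (a zero) a₀≉0)
      scaled : y *ₗ (a zero *ₗ b) +ᴹ y *ₗ rest ≈ᴹ 0ᴹ
      scaled = ≈ᴹ-trans (≈ᴹ-sym (*ₗ-distribˡ y _ _)) (≈ᴹ-trans (*ₗ-cong refl lc≈0) (*ₗ-zeroʳ y))

  extend-to-spanning : ∀ {p k d} {P : Carrierᴹ → Set p} {I : Fin k → Carrierᴹ} → Independent I →
    (B : Fin d → Carrierᴹ) → (∀ i → P (B i)) →
    ¬ ¬ (Σ[ r ∈ ℕ ] Σ[ J ∈ (Fin r → Carrierᴹ) ]
           (∀ j → P (J j)) × Independent (J ++ I) × (∀ i → B i ∈Span (J ++ I)))
  extend-to-spanning {d = zero}  ind B B∈ = return¬¬ (0 , (λ ()) , (λ ()) , ind , (λ ()))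
  extend-to-spanning {d = suc d} {P = P} {I = I} ind B B∈ =
    extend-to-spanning {P = P} ind (tail B) (B∈ ∘ suc) >>=¬¬ λ (r , J , J∈ , indJI , spanned) →
    ¬¬-excluded-middle {A = B zero ∈Span (J ++ I)} >>=¬¬ λ where
      (yes b∈) → return¬¬ (r , J , J∈ , indJI , λ { zero → b∈ ; (suc i) → spanned i })
      (no b∉)  → return¬¬ (suc r , (B zero ∷ J) , (λ { zero → B∈ zero ; (suc j) → J∈ j })
        , independent-≗ (≡.sym ∘ ∷-++ (B zero) J I) (independent-∷ indJI b∉)
        , λ { zero    → ∈Span-≗ (≡.sym ∘ ∷-++ (B zero) J I) (∷-∈Span (B zero) (J ++ I))
            ; (suc i) → ∈Span-≗ (≡.sym ∘ ∷-++ (B zero) J I) (∈Span-∷ (B zero) (spanned i)) })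

  independent-++ : ∀ {p q} {u : Fin p → Carrierᴹ} {v : Fin q → Carrierᴹ} → Independent v →
    (∀ a b → lc a u +ᴹ lc b v ≈ᴹ 0ᴹ → ∀ i → ¬ ¬ (a i ≈ 0#)) → Independent (u ++ v)
  independent-++ {p} {q} {u} {v} ind-v u-part c lc≈0 i =
    ≡.subst (λ x → ¬ ¬ (x ≈ 0#)) (≡.sym (++-split {p = p} c i)) (++-∀ {P = λ x → ¬ ¬ (x ≈ 0#)} a b a≈0 b≈0 i)
    where
    a : Fin p → Carrier
    a = c ∘ (_↑ˡ q)
    b : Fin q → Carrier
    b = c ∘ (p ↑ʳ_)
    split : lc a u +ᴹ lc b v ≈ᴹ 0ᴹ
    split = ≈ᴹ-trans (≈ᴹ-sym (lc-split c u v)) lc≈0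
    a≈0 : ∀ j → ¬ ¬ (a j ≈ 0#)
    a≈0 = u-part a b split
    b≈0 : ∀ j → ¬ ¬ (b j ≈ 0#)
    b≈0 j = ¬¬-∀Fin p a≈0 >>=¬¬ λ all-a≈0 → ind-v b
      (≈ᴹ-trans (≈ᴹ-sym (+ᴹ-identityˡ (lc b v)))
                (≈ᴹ-trans (+ᴹ-cong (≈ᴹ-sym (lc-zero u all-a≈0)) ≈ᴹ-refl) split)) j

  independent-direct-sum : ∀ {p q r s} {P : Carrierᴹ → Set r} {Q : Carrierᴹ → Set s}
    {u : Fin p → Carrierᴹ} {v : Fin q → Carrierᴹ} → IsSubspace P → IsSubspace Q →
    (∀ x → P x → Q x → x ≈ᴹ 0ᴹ) → (∀ i → P (u i)) → (∀ j → Q (v j)) →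
    Independent u → Independent v → Independent (u ++ v)
  independent-direct-sum {u = u} {v} SP SQ P∩Q≈0 u∈ v∈ ind-u ind-v =
    independent-++ ind-v λ a b lc≈0 → ind-u a (P∩Q≈0 (lc a u) (lc∈ SP a u u∈)
      (resp SQ (≈ᴹ-sym (inverseˡ-unique (lc a u) (lc b v) lc≈0)) (-ᴹ∈ SQ (lc∈ SQ b v v∈))))

  record Basis {p} (P : Carrierᴹ → Set p) (d : ℕ) : Set (c ⊔ ℓ ⊔ m ⊔ ℓm ⊔ p) where
    field
      vector      : Fin d → Carrierᴹ
      member      : ∀ i → P (vector i)
      independent : Independent vector
      spanning    : ∀ x → P x → x ∈Span vector

  -- Let I be an independent family of
  -- k vectors in a space P with a basis of size dP, and let I′ be a family
  -- of l vectors in a space Q with a basis of size dQ.  If every family J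
  -- from P that is independent modulo I can be transported to a family L in
  -- Q that is independent modulo I′, then dim P / I ≤ dim Q / I′, i.e.
  -- dP + l ≤ dQ + k.
  dimension-comparison : ∀ {p q dP dQ k l} {P : Carrierᴹ → Set p} {Q : Carrierᴹ → Set q}
    {I : Fin k → Carrierᴹ} {I′ : Fin l → Carrierᴹ} → Basis P dP → Basis Q dQ → Independent I →
    (∀ {r} (J : Fin r → Carrierᴹ) → (∀ j → P (J j)) → Independent (J ++ I) →
       Σ[ L ∈ (Fin r → Carrierᴹ) ] (∀ i → Q ((L ++ I′) i)) × Independent (L ++ I′)) →
    dP +ℕ l ≤ dQ +ℕ k
  dimension-comparison {dP = dP} {dQ} {k} {l} {P = P} {I = I} {I′} BP BQ ind-I transport =
    decidable-stable (dP +ℕ l ≤? dQ +ℕ k)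
      (extend-to-spanning {P = P} ind-I (vector BP) (member BP) >>=¬¬ λ (r , J , J∈ , indJI , spanned) →
       let (L , LI′∈ , indLI′) = transport J J∈ indJI in
       steinitz (r +ℕ k) (vector BP) (J ++ I) (independent BP) spanned >>=¬¬ λ dP≤r+k →
       steinitz dQ (L ++ I′) (vector BQ) indLI′ (λ i → spanning BQ _ (LI′∈ i)) >>=¬¬ λ r+l≤dQ →
       return¬¬ (≤-exchange dP≤r+k r+l≤dQ))
    where open Basis
module FormLinearity {c ℓ} (𝔽 : Field c ℓ) (n : ℕ) where
  import Algebra.Module.Construct.TensorUnit as TensorUnit
  import Algebra.Module.Construct.DirectProduct as DirectProduct
  open import Data.Maybe using (nothing)
  open import Data.Product using (_×_)
  open import Tactic.RingSolver using (solve-∀)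
  open import Tactic.RingSolver.Core.AlmostCommutativeRing using (AlmostCommutativeRing; fromCommutativeRing)
  open Field 𝔽 hiding (zero)
  open import Algebra.Properties.Ring ring using (-‿distribʳ-*)
  open LeftModule (DirectProduct.leftModule {R = ring} TensorUnit.leftModule TensorUnit.leftModule)
    using () renaming (_≈ᴹ_ to _≈²_; _+ᴹ_ to _+²_; _*ₗ_ to _*²_; 0ᴹ to 0²)

  R : AlmostCommutativeRing c ℓ
  R = fromCommutativeRing commutativeRing (λ _ → nothing)

  module Identities where
    open AlmostCommutativeRing R using () renaming (_≈_ to _≈R_; _+_ to _+R_; _*_ to _*R_; -_ to -R_)

    plus-+ : ∀ a a' b b' x y → (a +R a') *R y +R (b +R b') *R x ≈R (a *R y +R b *R x) +R (a' *R y +R b' *R x)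
    plus-+ = solve-∀ R
    minus-+ : ∀ a a' b b' x y → (a +R a') *R y +R -R ((b +R b') *R x) ≈R (a *R y +R -R (b *R x)) +R (a' *R y +R -R (b' *R x))
    minus-+ = solve-∀ R

  open Identities using (plus-+; minus-+)

  ⟨_,_⟩[_] : Carrier × Carrier → Carrier × Carrier → Sign → Carrier
  ⟨ u , e ⟩[ s ] = ⟪_,_⟫ 𝔽 s n u e

  form-cong : ∀ s e {u v} → u ≈² v → ⟨ u , e ⟩[ s ] ≈ ⟨ v , e ⟩[ s ]
  form-cong plus  e (p , q) = +-cong (*-congʳ p) (*-congʳ q)
  form-cong minus e (p , q) = +-cong (*-congʳ p) (-‿cong (*-congʳ q))

  form-0 : ∀ s e → ⟨ 0² , e ⟩[ s ] ≈ 0#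
  form-0 plus  e = trans (+-cong (zeroˡ _) (zeroˡ _)) (+-identityˡ 0#)
  form-0 minus e = trans (+-cong (zeroˡ _) (-‿cong (zeroˡ _))) (-‿inverseʳ 0#)

  form-+ : ∀ s e u v → ⟨ u +² v , e ⟩[ s ] ≈ ⟨ u , e ⟩[ s ] + ⟨ v , e ⟩[ s ]
  form-+ plus  e u v = plus-+ _ _ _ _ _ _
  form-+ minus e u v = minus-+ _ _ _ _ _ _

  form-*ₗ : ∀ s e k u → ⟨ k *² u , e ⟩[ s ] ≈ k * ⟨ u , e ⟩[ s ]
  form-*ₗ plus  e k u = trans (+-cong (*-assoc _ _ _) (*-assoc _ _ _)) (sym (distribˡ _ _ _))
  form-*ₗ minus e k u = trans (+-cong (*-assoc _ _ _) (trans (-‿cong (*-assoc _ _ _)) (-‿distribʳ-* _ _)))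
                              (sym (distribˡ _ _ _))

module ChainGroups {c ℓ} (𝔽 : Field c ℓ) (s : Sign) (n : ℕ) where
  import Algebra.Module.Construct.TensorUnit as TensorUnit
  import Algebra.Module.Construct.DirectProduct as DirectProduct
  open import Data.Bool using (true; false)
  open import Data.Nat using () renaming (_+_ to _+ℕ_)
  open import Data.Fin using (Fin; _↑ˡ_; _↑ʳ_)
  open import Data.Fin.Subset using (_∈_; _∉_; _∩_)
  open import Data.Fin.Subset.Properties
    using (_∈?_; ⊆-antisym; x∈p∩q⁺; x∈p∩q⁻; p∩q⊆q; x∈p∪q⁺; x∈p∪q⁻; x∈p∧x∉q⇒x∈p─q; p─q⊆p; p─q─r≡p─q∪r)
  open import Data.Product using (Σ-syntax; _×_)
  open import Data.Sum using (inj₁; inj₂)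
  open import Data.Vec using (Vec; []; _∷_; lookup; tabulate)
  open import Data.Vec.Functional using (_++_)
  open import Data.Vec.Functional.Properties using (lookup-++ˡ)
  open import Data.Vec.Properties using ([]=⇒lookup; lookup⇒[]=; lookup∘tabulate)
  open import Data.Empty using (⊥; ⊥-elim)
  open import Function using (_∘_)
  open import Relation.Nullary using (¬_; yes; no)
  open import Relation.Binary.PropositionalEquality as ≡ using (_≡_)
  open FiniteFamilies using (return¬¬; ++-∀)
  open SubsetFacts using (x∈p─q⇒x∉q)
  open Field 𝔽 hiding (zero)

  -- K = 𝔽² and the chains Fin n → K, as 𝔽-modules whose operations are
  -- definitionally those of Defs.
  K-module : LeftModule ring c ℓ
  K-module = DirectProduct.leftModule TensorUnit.leftModule TensorUnit.leftModule

  chain-module : LeftModule ring c ℓ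
  chain-module = pointwise (Fin n) K-module

  module 𝕂 = LeftModule K-module
  open LeftModule chain-module
  open LinearAlgebra 𝔽 chain-module public
  open import Relation.Binary.Reasoning.Setoid ≈ᴹ-setoid

  Ch : Set c
  Ch = Chain 𝔽 s n

  open FormLinearity 𝔽 n

  _∣_ : Ch → Subset n → Ch
  f ∣ S = restrict 𝔽 s n f S

  restrict-∈ : ∀ f {S x} → x ∈ S → (f ∣ S) x 𝕂.≈ᴹ f x
  restrict-∈ f {S} {x} x∈S rewrite []=⇒lookup x∈S = 𝕂.≈ᴹ-refl

  restrict-∉ : ∀ f {S x} → x ∉ S → (f ∣ S) x 𝕂.≈ᴹ 𝕂.0ᴹ
  restrict-∉ f {S} {x} x∉S with lookup S x in eq
  ... | true  = ⊥-elim (x∉S (lookup⇒[]= x S eq))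
  ... | false = 𝕂.≈ᴹ-refl

  restrict-linear : ∀ S → IsLinear (_∣ S)
  restrict-linear S = record { cong = cong′ ; +-hom = +-hom′ ; *ₗ-hom = *ₗ-hom′ }
    where
    cong′ : ∀ {f g} → f ≈ᴹ g → f ∣ S ≈ᴹ g ∣ S
    cong′ f≈g x with lookup S x
    ... | true  = f≈g x
    ... | false = 𝕂.≈ᴹ-refl

    +-hom′ : ∀ f g → (f +ᴹ g) ∣ S ≈ᴹ f ∣ S +ᴹ g ∣ S
    +-hom′ f g x with lookup S x
    ... | true  = 𝕂.≈ᴹ-refl
    ... | false = 𝕂.≈ᴹ-sym (𝕂.+ᴹ-identityˡ 𝕂.0ᴹ)

    *ₗ-hom′ : ∀ k f → (k *ₗ f) ∣ S ≈ᴹ k *ₗ (f ∣ S)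
    *ₗ-hom′ k f x with lookup S x
    ... | true  = 𝕂.≈ᴹ-refl
    ... | false = 𝕂.≈ᴹ-sym (𝕂.*ₗ-zeroʳ k)

  VanishesOutside : Subset n → Ch → Set ℓ
  VanishesOutside S f = ∀ x → x ∉ S → f x 𝕂.≈ᴹ 𝕂.0ᴹ

  vanishing-subspace : ∀ S → IsSubspace (VanishesOutside S)
  vanishing-subspace S = record
    { resp = λ f≈g f0 x x∉S → 𝕂.≈ᴹ-trans (𝕂.≈ᴹ-sym (f≈g x)) (f0 x x∉S)
    ; 0∈   = λ _ _ → 𝕂.≈ᴹ-refl
    ; +∈   = λ f0 g0 x x∉S → 𝕂.≈ᴹ-trans (𝕂.+ᴹ-cong (f0 x x∉S) (g0 x x∉S)) (𝕂.+ᴹ-identityˡ 𝕂.0ᴹ)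
    ; *ₗ∈  = λ k f0 x x∉S → 𝕂.≈ᴹ-trans (𝕂.*ₗ-cong refl (f0 x x∉S)) (𝕂.*ₗ-zeroʳ k)
    }

  restrict-vanishes : ∀ f S → VanishesOutside S (f ∣ S)
  restrict-vanishes f S x = restrict-∉ f

  restrict-∩ : ∀ f A B → (f ∣ A) ∣ B ≈ᴹ f ∣ (A ∩ B)
  restrict-∩ f A B x with x ∈? A | x ∈? B
  ... | yes x∈A | yes x∈B = 𝕂.≈ᴹ-trans (restrict-∈ (f ∣ A) x∈B)
      (𝕂.≈ᴹ-trans (restrict-∈ f x∈A) (𝕂.≈ᴹ-sym (restrict-∈ f (x∈p∩q⁺ (x∈A , x∈B)))))
  ... | no  x∉A | yes x∈B = 𝕂.≈ᴹ-trans (restrict-∈ (f ∣ A) x∈B)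
      (𝕂.≈ᴹ-trans (restrict-∉ f x∉A) (𝕂.≈ᴹ-sym (restrict-∉ f (x∉A ∘ proj₁ ∘ x∈p∩q⁻ A B))))
  ... | _       | no  x∉B = 𝕂.≈ᴹ-trans (restrict-∉ (f ∣ A) x∉B)
      (𝕂.≈ᴹ-sym (restrict-∉ f (x∉B ∘ proj₂ ∘ x∈p∩q⁻ A B)))

  restrict-restrict : ∀ f {A B} → B ⊆ A → (f ∣ A) ∣ B ≈ᴹ f ∣ B
  restrict-restrict f {A} {B} B⊆A = ≡.subst (λ C → (f ∣ A) ∣ B ≈ᴹ f ∣ C)
    (⊆-antisym (p∩q⊆q A B) (λ x∈B → x∈p∩q⁺ (B⊆A x∈B , x∈B))) (restrict-∩ f A B)

  restrict-split : ∀ f {S T} → T ⊆ S → f ∣ S ≈ᴹ f ∣ T +ᴹ f ∣ (S ─ T)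
  restrict-split f {S} {T} T⊆S x with x ∈? T | x ∈? S
  ... | yes x∈T | _       = 𝕂.≈ᴹ-trans (restrict-∈ f (T⊆S x∈T)) (𝕂.≈ᴹ-sym (𝕂.≈ᴹ-trans
      (𝕂.+ᴹ-cong (restrict-∈ f x∈T) (restrict-∉ f {S ─ T} (λ x∈S─T → x∈p─q⇒x∉q {p = S} x∈S─T x∈T)))
      (𝕂.+ᴹ-identityʳ (f x))))
  ... | no  x∉T | yes x∈S = 𝕂.≈ᴹ-trans (restrict-∈ f x∈S) (𝕂.≈ᴹ-sym (𝕂.≈ᴹ-trans
      (𝕂.+ᴹ-cong (restrict-∉ f x∉T) (restrict-∈ f (x∈p∧x∉q⇒x∈p─q x∈S x∉T)))
      (𝕂.+ᴹ-identityˡ (f x))))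
  ... | no  x∉T | no  x∉S = 𝕂.≈ᴹ-trans (restrict-∉ f x∉S) (𝕂.≈ᴹ-sym (𝕂.≈ᴹ-trans
      (𝕂.+ᴹ-cong (restrict-∉ f x∉T) (restrict-∉ f (x∉S ∘ p─q⊆p S T)))
      (𝕂.+ᴹ-identityˡ 𝕂.0ᴹ)))

  restrict-id : ∀ {f S} → VanishesOutside S f → f ∣ S ≈ᴹ f
  restrict-id {f} {S} f0 x with x ∈? S
  ... | yes x∈S = restrict-∈ f x∈S
  ... | no  x∉S = 𝕂.≈ᴹ-trans (restrict-∉ f x∉S) (𝕂.≈ᴹ-sym (f0 x x∉S))

  vanishing-disjoint : ∀ {A B f} → (∀ {x} → x ∈ A → x ∉ B) →
    VanishesOutside A f → VanishesOutside B f → f ≈ᴹ 0ᴹ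
  vanishing-disjoint {A} A∩B=∅ fA fB x with x ∈? A
  ... | yes x∈A = fB x (A∩B=∅ x∈A)
  ... | no  x∉A = fA x x∉A

  restrict-disjoint : ∀ {A B f} → (∀ {x} → x ∈ A → x ∉ B) → VanishesOutside B f → f ∣ A ≈ᴹ 0ᴹ
  restrict-disjoint {A} {f = f} A∩B=∅ f0 x with x ∈? A
  ... | yes x∈A = 𝕂.≈ᴹ-trans (restrict-∈ f x∈A) (f0 x (A∩B=∅ x∈A))
  ... | no  x∉A = restrict-∉ f x∉A

  Orthogonal : Subset n → K 𝔽 s n → Ch → Set ℓ
  Orthogonal W e f = ∀ x → x ∈ W → ⟨ f x , e ⟩[ s ] ≈ 0#

  orthogonal-subspace : ∀ W e → IsSubspace (Orthogonal W e)
  orthogonal-subspace W e = record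
    { resp = λ f≈g f⊥ x x∈W → trans (form-cong s e (𝕂.≈ᴹ-sym (f≈g x))) (f⊥ x x∈W)
    ; 0∈   = λ _ _ → form-0 s e
    ; +∈   = λ {f} {g} f⊥ g⊥ x x∈W → trans (form-+ s e (f x) (g x))
                 (trans (+-cong (f⊥ x x∈W) (g⊥ x x∈W)) (+-identityˡ 0#))
    ; *ₗ∈  = λ k {f} f⊥ x x∈W → trans (form-*ₗ s e k (f x)) (trans (*-congˡ (f⊥ x x∈W)) (zeroʳ k))
    }

  orthogonal-restrict : ∀ {W e f} S → Orthogonal W e f → Orthogonal W e (f ∣ S)
  orthogonal-restrict {e = e} {f} S f⊥ x x∈W with x ∈? S
  ... | yes x∈S = trans (form-cong s e (restrict-∈ f x∈S)) (f⊥ x x∈W)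
  ... | no  x∉S = trans (form-cong s e (restrict-∉ f x∉S)) (form-0 s e)

  chain-group-subspace : ∀ {S N} → IsChainGroupOn 𝔽 s n S N → IsSubspace N
  chain-group-subspace G = record
    { resp = λ {f} {g} → G.resp f g ; 0∈ = G.zero∈ ; +∈ = λ {f} {g} → G.+-closed f g
    ; *ₗ∈ = λ k {f} → G.·-closed k f }
    where module G = IsChainGroupOn G

  ×ₘ-elim : ∀ {S N} → IsChainGroupOn 𝔽 s n S N → ∀ T {g} → (_×ₘ_ 𝔽 s n N T) g → N g × VanishesOutside T g
  ×ₘ-elim G T (f , f∈N , f0 , g≈) =
    resp (chain-group-subspace G) (≈ᴹ-trans (≈ᴹ-sym (restrict-id f0)) (≈ᴹ-sym g≈)) f∈N ,
    resp (vanishing-subspace T) (≈ᴹ-sym g≈) (restrict-vanishes f T)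

  ×ₘ-intro : ∀ {N} T {g} → N g → VanishesOutside T g → (_×ₘ_ 𝔽 s n N T) g
  ×ₘ-intro T {g} g∈N g0 = g , g∈N , g0 , ≈ᴹ-sym (restrict-id g0)

  lincomb≈lc : ∀ {d} (ks : Vec Carrier d) (B : Vec Ch d) → lincomb 𝔽 s n ks B ≈ᴹ lc (lookup ks) (lookup B)
  lincomb≈lc []       []      = ≈ᴹ-refl
  lincomb≈lc (k ∷ ks) (b ∷ B) = +ᴹ-cong ≈ᴹ-refl (lincomb≈lc ks B)

  basis : ∀ {P d} → HasDim 𝔽 s n P d → Basis P d
  basis (B , B∈ , independent , spanning) = record
    { vector      = lookup B
    ; member      = B∈
    ; independent = λ a lc≈0 i → return¬¬ (trans (sym (reflexive (lookup∘tabulate a i)))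
        (independent (tabulate a) (≈ᴹ-trans (lincomb≈lc (tabulate a) B)
          (≈ᴹ-trans (lc-cong (λ j → reflexive (lookup∘tabulate a j)) (λ _ → ≈ᴹ-refl)) lc≈0)) i))
    ; spanning    = λ f f∈P → let (ks , f≈) = spanning f f∈P in
        lookup ks , ≈ᴹ-trans f≈ (lincomb≈lc ks B)
    }

  ×ₘ-basis : ∀ {S N d} → IsChainGroupOn 𝔽 s n S N → ∀ T → HasDim 𝔽 s n (_×ₘ_ 𝔽 s n N T) d →
    Basis (λ g → N g × VanishesOutside T g) d
  ×ₘ-basis G T dim = record
    { vector = vector ; member = λ i → ×ₘ-elim G T (member i) ; independent = independent
    ; spanning = λ g (g∈N , g0) → spanning g (×ₘ-intro T g∈N g0) }
    where open Basis (basis dim)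

  module Minor {V X Y : Subset n} {N : ChainSet 𝔽 s n} (N-group : IsChainGroupOn 𝔽 s n V N)
    (Y⊆V : Y ⊆ V) (X∩Y=∅ : ∀ x → x ∈ X → x ∈ Y → ⊥) where

    V' : Subset n
    V' = V ─ (X ∪ Y)

    N₀ : Ch → Set (c ⊔ ℓ)
    N₀ f = N f × Orthogonal X (e₂ 𝔽 s n) f × Orthogonal Y (e₁ 𝔽 s n) f

    N₀-subspace : IsSubspace N₀
    N₀-subspace = ∩-subspace (chain-group-subspace N-group)
                    (∩-subspace (orthogonal-subspace X (e₂ 𝔽 s n)) (orthogonal-subspace Y (e₁ 𝔽 s n)))

    Y⊆V─X : Y ⊆ V ─ X
    Y⊆V─X x∈Y = x∈p∧x∉q⇒x∈p─q (Y⊆V x∈Y) (λ x∈X → X∩Y=∅ _ x∈X x∈Y)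

    -- contraction restricts to V ∖ X, deletion then to (V ∖ X) ∖ Y = V'
    two-stage : ∀ f → (f ∣ (V ─ X)) ∣ ((V ─ X) ─ Y) ≈ᴹ f ∣ V'
    two-stage f = ≡.subst (λ S → (f ∣ (V ─ X)) ∣ ((V ─ X) ─ Y) ≈ᴹ f ∣ S) (p─q─r≡p─q∪r V X Y)
                    (restrict-restrict f (p─q⊆p (V ─ X) Y))

    project : ∀ {f} → N₀ f → minorₘ 𝔽 s n V N X Y (f ∣ V')
    project {f} (f∈N , f⊥X , f⊥Y) =
      f ∣ (V ─ X) , (f , f∈N , f⊥X , ≈ᴹ-refl) ,
      (λ x x∈Y → trans (form-cong s (e₁ 𝔽 s n) (restrict-∈ f (Y⊆V─X x∈Y))) (f⊥Y x x∈Y)) ,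
      ≈ᴹ-sym (two-stage f)

    lift : ∀ {g} → minorₘ 𝔽 s n V N X Y g → Σ[ f ∈ Ch ] N₀ f × g ≈ᴹ f ∣ V'
    lift {g} (f′ , (f , f∈N , f⊥X , f′≈) , f′⊥Y , g≈) = f , (f∈N , f⊥X , f⊥Y) , g≈f∣V'
      where
      f⊥Y : Orthogonal Y (e₁ 𝔽 s n) f
      f⊥Y x x∈Y = trans (form-cong s (e₁ 𝔽 s n)
        (𝕂.≈ᴹ-sym (𝕂.≈ᴹ-trans (f′≈ x) (restrict-∈ f (Y⊆V─X x∈Y))))) (f′⊥Y x x∈Y)
      g≈f∣V' : g ≈ᴹ f ∣ V'
      g≈f∣V' = ≈ᴹ-trans g≈ (≈ᴹ-trans (cong (restrict-linear ((V ─ X) ─ Y)) f′≈) (two-stage f))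

  module Comparison {V X Y T U : Subset n} {N M : ChainSet 𝔽 s n}
    (N-group : IsChainGroupOn 𝔽 s n V N) (Y⊆V : Y ⊆ V) (X∩Y=∅ : ∀ x → x ∈ X → x ∈ Y → ⊥)
    (M⇒minor : ∀ {g} → M g → minorₘ 𝔽 s n V N X Y g)
    (minor⇒M : ∀ {g} → minorₘ 𝔽 s n V N X Y g → M g)
    (M-group : IsChainGroupOn 𝔽 s n (V ─ (X ∪ Y)) M)
    (T⊆V' : T ⊆ V ─ (X ∪ Y)) (U⊆V─V' : U ⊆ V ─ (V ─ (X ∪ Y)))
    {dT dT' dTU dTU' : ℕ}
    (α : Basis (λ g → M g × VanishesOutside T g) dT)
    (β : Basis (λ g → M g × VanishesOutside ((V ─ (X ∪ Y)) ─ T) g) dT')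
    (κ : Basis (λ g → N g × VanishesOutside (T ∪ U) g) dTU)
    (μ : Basis (λ g → N g × VanishesOutside (V ─ (T ∪ U)) g) dTU') where

    open Minor N-group Y⊆V X∩Y=∅
    open Basis

    Iₘ : Fin (dT +ℕ dT') → Ch
    Iₘ = vector α ++ vector β

    Iₙ : Fin (dTU +ℕ dTU') → Ch
    Iₙ = vector κ ++ vector μ

    disjoint-─ : ∀ {A B : Subset n} {x} → x ∈ B → x ∉ A ─ B
    disjoint-─ {A} x∈B x∈A─B = x∈p─q⇒x∉q {p = A} x∈A─B x∈B

    Iₘ-independent : Independent Iₘ
    Iₘ-independent = independent-direct-sum (vanishing-subspace T) (vanishing-subspace (V' ─ T))
      (λ _ → vanishing-disjoint disjoint-─) (proj₂ ∘ member α) (proj₂ ∘ member β)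
      (independent α) (independent β)

    Iₙ-independent : Independent Iₙ
    Iₙ-independent = independent-direct-sum (vanishing-subspace (T ∪ U)) (vanishing-subspace (V ─ (T ∪ U)))
      (λ _ → vanishing-disjoint disjoint-─) (proj₂ ∘ member κ) (proj₂ ∘ member μ)
      (independent κ) (independent μ)

    -- T ∪ U meets V' exactly in T, because U lies outside V'.
    T∪U∩V'≡T : (T ∪ U) ∩ V' ≡ T
    T∪U∩V'≡T = ⊆-antisym inside (λ x∈T → x∈p∩q⁺ (x∈p∪q⁺ (inj₁ x∈T) , T⊆V' x∈T))
      where
      inside : (T ∪ U) ∩ V' ⊆ T
      inside {x} x∈ with x∈p∩q⁻ (T ∪ U) V' x∈
      ... | x∈T∪U , x∈V' with x∈p∪q⁻ T U x∈T∪U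
      ...   | inj₁ x∈T = x∈T
      ...   | inj₂ x∈U = ⊥-elim (disjoint-─ {V} x∈V' (U⊆V─V' x∈U))

    N-subspace : IsSubspace N
    N-subspace = chain-group-subspace N-group

    M-subspace : IsSubspace M
    M-subspace = chain-group-subspace M-group

    module Lifted {r} (J : Fin r → Ch) (J∈M : ∀ j → M (J j)) where
      L : Fin r → Ch
      L j = proj₁ (lift (M⇒minor (J∈M j)))

      L∈N₀ : ∀ j → N₀ (L j)
      L∈N₀ j = proj₁ (proj₂ (lift (M⇒minor (J∈M j))))

      J≈L∣V' : ∀ j → J j ≈ᴹ L j ∣ V'
      J≈L∣V' j = proj₂ (proj₂ (lift (M⇒minor (J∈M j))))

      -- A relation  Σ zⱼ Lⱼ + Σ wᵢ (Iₙ)ᵢ = 0  in N yields the relation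
      -- Σ zⱼ Jⱼ = (an element of span Iₘ)  in M.
      module Relation (z : Fin r → Carrier) (w : Fin (dTU +ℕ dTU') → Carrier)
        (rel : lc z L +ᴹ lc w Iₙ ≈ᴹ 0ᴹ) where

        F G H : Ch
        F = lc z L
        G = lc (w ∘ (_↑ˡ dTU')) (vector κ)
        H = lc (w ∘ (dTU ↑ʳ_)) (vector μ)

        F∈N₀ : N₀ F
        F∈N₀ = lc∈ N₀-subspace z L L∈N₀

        G∈ : N G × VanishesOutside (T ∪ U) G
        G∈ = lc∈ (∩-subspace N-subspace (vanishing-subspace (T ∪ U))) _ (vector κ) (member κ)

        H-vanishes : VanishesOutside (V ─ (T ∪ U)) H
        H-vanishes = lc∈ (vanishing-subspace (V ─ (T ∪ U))) _ (vector μ) (proj₂ ∘ member μ)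

        F+G+H≈0 : F +ᴹ (G +ᴹ H) ≈ᴹ 0ᴹ
        F+G+H≈0 = ≈ᴹ-trans (+ᴹ-cong ≈ᴹ-refl (≈ᴹ-sym (lc-split w (vector κ) (vector μ)))) rel

        -- on T ∪ U the relation reads F + G = 0, since H vanishes there
        F∣T∪U≈-G : F ∣ (T ∪ U) ≈ᴹ -ᴹ G
        F∣T∪U≈-G = inverseˡ-unique (F ∣ (T ∪ U)) G (begin
          F ∣ (T ∪ U) +ᴹ G
            ≈⟨ +ᴹ-cong ≈ᴹ-refl (restrict-id (proj₂ G∈)) ⟨
          F ∣ (T ∪ U) +ᴹ G ∣ (T ∪ U)
            ≈⟨ +ᴹ-identityʳ _ ⟨
          F ∣ (T ∪ U) +ᴹ G ∣ (T ∪ U) +ᴹ 0ᴹ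
            ≈⟨ +ᴹ-cong ≈ᴹ-refl (restrict-disjoint disjoint-─ H-vanishes) ⟨
          F ∣ (T ∪ U) +ᴹ G ∣ (T ∪ U) +ᴹ H ∣ (T ∪ U)
            ≈⟨ +ᴹ-assoc _ _ _ ⟩
          F ∣ (T ∪ U) +ᴹ (G ∣ (T ∪ U) +ᴹ H ∣ (T ∪ U))
            ≈⟨ +ᴹ-cong ≈ᴹ-refl (+-hom (restrict-linear (T ∪ U)) G H) ⟨
          F ∣ (T ∪ U) +ᴹ (G +ᴹ H) ∣ (T ∪ U)
            ≈⟨ +-hom (restrict-linear (T ∪ U)) F (G +ᴹ H) ⟨
          (F +ᴹ (G +ᴹ H)) ∣ (T ∪ U)
            ≈⟨ cong (restrict-linear (T ∪ U)) F+G+H≈0 ⟩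
          0ᴹ ∣ (T ∪ U)
            ≈⟨ 0-hom (restrict-linear (T ∪ U)) ⟩
          0ᴹ ∎)

        F∣T∪U∈N₀ : N₀ (F ∣ (T ∪ U))
        F∣T∪U∈N₀ = resp N-subspace (≈ᴹ-sym F∣T∪U≈-G) (-ᴹ∈ N-subspace (proj₁ G∈))
                 , orthogonal-restrict (T ∪ U) (proj₁ (proj₂ F∈N₀))
                 , orthogonal-restrict (T ∪ U) (proj₂ (proj₂ F∈N₀))

        F∣T∈M : M (F ∣ T)
        F∣T∈M = resp M-subspace F∣T∪U∣V'≈F∣T (minor⇒M (project F∣T∪U∈N₀))
          where
          F∣T∪U∣V'≈F∣T : (F ∣ (T ∪ U)) ∣ V' ≈ᴹ F ∣ T
          F∣T∪U∣V'≈F∣T = ≡.subst (λ S → (F ∣ (T ∪ U)) ∣ V' ≈ᴹ F ∣ S) T∪U∩V'≡T (restrict-∩ F (T ∪ U) V')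

        F∣V'∈M : M (F ∣ V')
        F∣V'∈M = minor⇒M (project F∈N₀)

        F∣V'≈ : F ∣ V' ≈ᴹ F ∣ T +ᴹ F ∣ (V' ─ T)
        F∣V'≈ = restrict-split F T⊆V'

        F∣V'─T∈M : M (F ∣ (V' ─ T))
        F∣V'─T∈M = resp M-subspace
          (≈ᴹ-trans (+ᴹ-cong ≈ᴹ-refl F∣V'≈) (-ᴹ-cancelˡ (F ∣ T) (F ∣ (V' ─ T))))
          (+∈ M-subspace (-ᴹ∈ M-subspace F∣T∈M) F∣V'∈M)

        a : Fin dT → Carrier
        a = proj₁ (spanning α (F ∣ T) (F∣T∈M , restrict-vanishes F T))

        b : Fin dT' → Carrier
        b = proj₁ (spanning β (F ∣ (V' ─ T)) (F∣V'─T∈M , restrict-vanishes F (V' ─ T)))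

        Jz∈span : lc z J ≈ᴹ lc (a ++ b) Iₘ
        Jz∈span = begin
          lc z J                    ≈⟨ lc-cong (λ _ → refl) J≈L∣V' ⟩
          lc z (λ j → L j ∣ V')     ≈⟨ lc-hom (restrict-linear V') z L ⟨
          F ∣ V'                    ≈⟨ F∣V'≈ ⟩
          F ∣ T +ᴹ F ∣ (V' ─ T)     ≈⟨ +ᴹ-cong (proj₂ (spanning α _ _)) (proj₂ (spanning β _ _)) ⟩
          lc a (vector α) +ᴹ lc b (vector β) ≈⟨ lc-++ a b (vector α) (vector β) ⟨
          lc (a ++ b) Iₘ            ∎

        J-relation : lc (z ++ (λ i → - (a ++ b) i)) (J ++ Iₘ) ≈ᴹ 0ᴹ
        J-relation = begin
          lc (z ++ (λ i → - (a ++ b) i)) (J ++ Iₘ)   ≈⟨ lc-++ z _ J Iₘ ⟩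
          lc z J +ᴹ lc (λ i → - (a ++ b) i) Iₘ      ≈⟨ +ᴹ-cong Jz∈span (lc-neg (a ++ b) Iₘ) ⟩
          lc (a ++ b) Iₘ +ᴹ -ᴹ lc (a ++ b) Iₘ       ≈⟨ -ᴹ‿inverseʳ _ ⟩
          0ᴹ                                        ∎

      lifted-independent : Independent (J ++ Iₘ) → Independent (L ++ Iₙ)
      lifted-independent indJI = independent-++ Iₙ-independent λ z w rel j →
        ≡.subst (λ x → ¬ ¬ (x ≈ 0#)) (lookup-++ˡ z _ j)
          (indJI _ (Relation.J-relation z w rel) (j ↑ˡ (dT +ℕ dT')))

    transport : ∀ {r} (J : Fin r → Ch) → (∀ j → M (J j)) → Independent (J ++ Iₘ) →
      Σ[ L ∈ (Fin r → Ch) ] (∀ i → N ((L ++ Iₙ) i)) × Independent (L ++ Iₙ)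
    transport J J∈M indJI = L , ++-∀ {P = N} L Iₙ (proj₁ ∘ L∈N₀)
        (++-∀ {P = N} (vector κ) (vector μ) (proj₁ ∘ member κ) (proj₁ ∘ member μ))
      , lifted-independent indJI
      where open Lifted J J∈M

open import Data.Integer using (ℤ; _≤_)
open import Relation.Binary.PropositionalEquality using (refl)

theorem3p14 : ∀ {c ℓ} (𝔽 : Field c ℓ) (s : Sign) (n : ℕ)
    (V V' : Subset n) (N M : ChainSet 𝔽 s n) →
    IsChainGroupOn 𝔽 s n V N → IsChainGroupOn 𝔽 s n V' M →
    IsMinor 𝔽 s n V N V' M →
    ∀ (T U : Subset n) → T ⊆ V' → U ⊆ (V ─ V') →
    ∀ (l m : ℤ) → TwiceLambda 𝔽 s n V' M T l → TwiceLambda 𝔽 s n V N (T ∪ U) m →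
    l ≤ m
theorem3p14 𝔽 s n V _ N M N-group M-group (X , Y , _ , Y⊆V , X∩Y=∅ , refl , M↔minor) T U T⊆V' U⊆V─V' _ _
  (a' , b' , e' , dimM , dimM×V'∖T , dimM×T , refl) (a , b , e , dimN , dimN×V∖T∪U , dimN×T∪U , refl) =
  difference-≤ {a} {b} {e} {a'} {b'} {e'} (dimension-comparison (basis dimM) (basis dimN) Iₘ-independent transport)
  where
  open IntegerArithmetic using (difference-≤)
  open ChainGroups 𝔽 s n
  open Comparison N-group Y⊆V X∩Y=∅ (proj₁ (M↔minor _)) (proj₂ (M↔minor _)) M-group T⊆V' U⊆V─V'
    (×ₘ-basis M-group T dimM×T) (×ₘ-basis M-group ((V ─ (X ∪ Y)) ─ T) dimM×V'∖T)
    (×ₘ-basis N-group (T ∪ U) dimN×T∪U) (×ₘ-basis N-group (V ─ (T ∪ U)) dimN×V∖T∪U)
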